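{- Let $(L_n)_{n\ge0}$ be the Lucas sequence. Let $K$ be the set of integers of the form $L_0+L_2+\sum_{i\in I}L_i$ where $I$ is a finite (possibly empty) subset of $\{4,5,6,\ldots\}$ containing no two consecutive integers, and let $q(1)<q(2)<\cdots$ be the elements of $K$ in increasing order. Let $S$ be the golden string. Then for every $j\ge 1$, $$q(j+1)-q(j)=\begin{cases}L_3,&\text{if the $j$th character of $S$ is $A$},\\ L_4,&\text{if the $j$th character of $S$ is $B$}.\end{cases}$$
   Context: $L_0=2$, $L_1=1$, $L_n=L_{n-1}+L_{n-2}$ ($n\ge2$). The golden string $S=BABBABABBABBA\ldots$ is the infinite string over $\{A,B\}$ defined by $S_1=A$, $S_2=B$, $S_k=S_{k-1}S_{k-2}$ (concatenation) for $k\ge3$; each $S_k$ ($k\ge2$) is a prefix of $S_{k+1}$ and $S$ is the limit string. -}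

module Defs where

open import Data.Nat using (ℕ; zero; suc; _+_; _≤_)
open import Data.List using (List; []; _∷_; _++_; map)
open import Data.Nat.ListAction using (sum)
open import Data.List.Membership.Propositional using (_∈_; _∉_)
open import Data.List.Relation.Unary.All using (All)
open import Data.List.Relation.Unary.Unique.Propositional using (Unique)
open import Data.Maybe using (Maybe; just; nothing)
open import Data.Product using (Σ; _×_)
open import Relation.Binary.PropositionalEquality using (_≡_)

L : ℕ → ℕ
L zero = 2
L (suc zero) = 1
L (suc (suc n)) = L (suc n) + L n

K : ℕ → Set
K n = Σ (List ℕ) λ I →
        Unique I × All (4 ≤_) I × (∀ i → i ∈ I → suc i ∉ I) ×
        (n ≡ L 0 + L 2 + sum (map L I))

data Letter : Set where
  A B : Letter

-- Finite golden words: S 1 = A, S 2 = B, S k = S (k-1) ++ S (k-2) (k ≥ 3).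
-- (S 0 is an unused dummy value.)
S : ℕ → List Letter
S zero = []
S (suc zero) = A ∷ []
S (suc (suc zero)) = B ∷ []
S (suc (suc (suc k))) = S (suc (suc k)) ++ S (suc k)

-- 1-indexed character lookup.
charAt : List Letter → ℕ → Maybe Letter
charAt [] _ = nothing
charAt (x ∷ xs) zero = nothing
charAt (x ∷ xs) (suc zero) = just x
charAt (x ∷ xs) (suc (suc j)) = charAt xs (suc j)

-- The sums Σ_{i∈I} L_i over admissible I ⊆ {4,…,m+2}, listed increasingly,
-- obey the recursion of the golden words: the list for m+2 is the list for
-- m+1 followed by the list for m shifted by L(m+4).  Appending L(m+3), whose
-- shift by L(m+4) is L(m+5), the successive differences of the list for m
-- spell S_{m+1} with A ↦ L₃ and B ↦ L₄.  Shifted by L₀ + L₂, these lists are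
-- initial segments of K, so the increasing enumeration q of K runs through
-- them in order.
module Submission where

open import Defs
open import Data.Nat using (ℕ; zero; suc; _+_; _≤_; _<_; _≤′_; ≤′-refl; ≤′-step; z≤n; s≤s; z<s; _≟_)
open import Data.Nat.Properties
open import Data.Nat.ListAction using (sum)
open import Data.Nat.ListAction.Properties using (sum-↭)
open import Data.List using (List; []; _∷_; _++_; map)
open import Data.List.Properties using (++-assoc; map-++)
open import Data.List.Membership.Propositional using (_∈_; _∉_)
open import Data.List.Membership.Propositional.Properties using (∈-++⁺ˡ; ∈-++⁺ʳ; ∈-++⁻; ∈-map⁺; ∈-map⁻; ∈-∃++)
open import Data.List.Membership.DecPropositional _≟_ using (_∈?_)
open import Data.List.Relation.Unary.Any using (here; there)
open import Data.List.Relation.Unary.All as All using (All; []; _∷_)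
open import Data.List.Relation.Unary.All.Properties as All using ()
open import Data.List.Relation.Unary.AllPairs using (AllPairs; []; _∷_)
open import Data.List.Relation.Unary.Linked using (Linked; [-]; _∷_)
open import Data.List.Relation.Unary.Linked.Properties using (Linked⇒AllPairs)
open import Data.List.Relation.Unary.Unique.Propositional using (Unique)
open import Data.List.Relation.Binary.Permutation.Propositional using (_↭_; ↭-sym; ↭⇒↭ₛ)
open import Data.List.Relation.Binary.Permutation.Propositional.Properties using (shift; map⁺; ∈-resp-↭; All-resp-↭)
open import Data.List.Relation.Binary.Permutation.Setoid.Properties using (Unique-resp-↭)
open import Data.Maybe using (just)
open import Data.Product using (Σ; ∃-syntax; _×_; _,_)
open import Data.Sum using (inj₁; inj₂)
open import Function using (_∘_)
open import Relation.Binary.PropositionalEquality using (_≡_; refl; sym; trans; cong; subst; setoid; module ≡-Reasoning)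
open import Relation.Nullary using (yes; no; contradiction)

record Enumerates (P : ℕ → Set) (q : ℕ → ℕ) : Set where
  field
    increasing : ∀ j → q j < q (suc j)
    members    : ∀ j → P (q j)
    onto       : ∀ {n} → P n → ∃[ j ] q j ≡ n

  first-least : ∀ j → q 0 ≤ q j
  first-least zero    = ≤-refl
  first-least (suc j) = ≤-trans (first-least j) (<⇒≤ (increasing j))

  drop-first : Enumerates (λ n → P n × q 0 < n) (q ∘ suc)
  drop-first = record
    { increasing = increasing ∘ suc
    ; members    = λ j → members (suc j) , ≤-<-trans (first-least j) (increasing j)
    ; onto       = onto′
    }
    where
    onto′ : ∀ {n} → P n × q 0 < n → ∃[ j ] q (suc j) ≡ n
    onto′ (Pn , q0<n) with onto Pn
    ... | zero  , refl = contradiction q0<n (<-irrefl refl)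
    ... | suc j , e    = j , e

open Enumerates

enumerates-from-1 : ∀ {P q} →
  (∀ j → 1 ≤ j → q j < q (suc j)) →
  (∀ j → 1 ≤ j → P (q j)) →
  (∀ n → P n → Σ ℕ λ j → 1 ≤ j × q j ≡ n) →
  Enumerates P (q ∘ suc)
enumerates-from-1 {P} {q} inc mem surj = record
  { increasing = λ j → inc (suc j) (s≤s z≤n)
  ; members    = λ j → mem (suc j) (s≤s z≤n)
  ; onto       = onto′
  }
  where
  onto′ : ∀ {n} → P n → ∃[ j ] q (suc j) ≡ n
  onto′ Pn with surj _ Pn
  ... | suc j , _ , e = j , e

InitialSegment : (ℕ → Set) → List ℕ → Set
InitialSegment P xs = ∀ {y z} → P y → z ∈ xs → y ≤ z → y ∈ xs

data _IsPrefixOf_ : List ℕ → (ℕ → ℕ) → Set where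
  []  : ∀ {q} → [] IsPrefixOf q
  _∷_ : ∀ {x xs q} → q 0 ≡ x → xs IsPrefixOf (q ∘ suc) → (x ∷ xs) IsPrefixOf q

initialSegment-head : ∀ {P q x xs} → Enumerates P q → All (x <_) xs → P x →
  InitialSegment P (x ∷ xs) → q 0 ≡ x
initialSegment-head e x<xs Px seg with j , refl ← onto e Px
  with seg (members e 0) (here refl) (first-least e j)
... | here q0≡x    = q0≡x
... | there q0∈xs = contradiction (first-least e j) (<⇒≱ (All.lookup x<xs q0∈xs))

initialSegment-tail : ∀ {P x xs} → All (x <_) xs → InitialSegment P (x ∷ xs) →
  InitialSegment (λ n → P n × x < n) xs
initialSegment-tail x<xs seg (Py , x<y) z∈xs y≤z with seg Py (there z∈xs) y≤z
... | here refl  = contradiction x<y (<-irrefl refl)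
... | there y∈xs = y∈xs

initialSegment-isPrefix : ∀ {P q xs} → Enumerates P q → AllPairs _<_ xs → All P xs →
  InitialSegment P xs → xs IsPrefixOf q
initialSegment-isPrefix _ [] [] _ = []
initialSegment-isPrefix e (x<xs ∷ sorted) (Px ∷ Pxs) seg
  with refl ← initialSegment-head e x<xs Px seg =
  refl ∷ initialSegment-isPrefix (drop-first e) sorted (All.zip (Pxs , x<xs))
           (initialSegment-tail x<xs seg)

gap : Letter → ℕ
gap A = L 3
gap B = L 4

gap-pos : ∀ l → 0 < gap l
gap-pos A = z<s
gap-pos B = z<s

data Gaps : List ℕ → List Letter → Set where
  [-] : ∀ {x} → Gaps (x ∷ []) []
  _∷_ : ∀ {x y xs l w} → y ≡ x + gap l → Gaps (y ∷ xs) w → Gaps (x ∷ y ∷ xs) (l ∷ w)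

gaps-shift : ∀ c {xs w} → Gaps xs w → Gaps (map (c +_) xs) w
gaps-shift c [-]                       = [-]
gaps-shift c (_∷_ {x} {l = l} refl gs) = sym (+-assoc c x (gap l)) ∷ gaps-shift c gs

gaps-++ : ∀ xs {y ys v w} → Gaps (xs ++ y ∷ []) v → Gaps (y ∷ ys) w → Gaps (xs ++ y ∷ ys) (v ++ w)
gaps-++ []            [-]       gs = gs
gaps-++ (_ ∷ [])      (e ∷ [-]) gs = e ∷ gs
gaps-++ (_ ∷ x′ ∷ xs) (e ∷ gs′) gs = e ∷ gaps-++ (x′ ∷ xs) gs′ gs

gaps⇒increasing : ∀ {xs w} → Gaps xs w → Linked _<_ xs
gaps⇒increasing [-]                   = [-]
gaps⇒increasing (_∷_ {l = l} refl gs) = m<m+n _ (gap-pos l) ∷ gaps⇒increasing gs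

isPrefix-gap : ∀ {xs w q} → xs IsPrefixOf q → Gaps xs w →
  ∀ i {c} → charAt w (suc i) ≡ just c → q (suc i) ≡ q i + gap c
isPrefix-gap _                 [-]      _       ()
isPrefix-gap (refl ∷ refl ∷ _) (e ∷ _)  zero    refl = e
isPrefix-gap (_ ∷ p)           (_ ∷ gs) (suc i) c∈   = isPrefix-gap p gs i c∈

L-suc-mono : ∀ {m n} → m ≤′ n → L (suc m) ≤ L (suc n)
L-suc-mono ≤′-refl        = ≤-refl
L-suc-mono (≤′-step m≤n) = ≤-trans (L-suc-mono m≤n) (m≤m+n _ _)

L-mono-≤ : ∀ {m n} → 1 ≤ m → m ≤ n → L m ≤ L n
L-mono-≤ {suc m} {suc n} _ (s≤s m≤n) = L-suc-mono (≤⇒≤′ m≤n)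

∈⇒↭∷ : ∀ {x : ℕ} {xs} → x ∈ xs → ∃[ ys ] xs ↭ x ∷ ys
∈⇒↭∷ x∈xs with ys , zs , refl ← ∈-∃++ x∈xs = ys ++ zs , shift _ ys zs

sum-L-↭∷ : ∀ {i I J} → I ↭ i ∷ J → sum (map L I) ≡ L i + sum (map L J)
sum-L-↭∷ I↭ = sum-↭ (map⁺ L I↭)

L≤sum : ∀ {i I} → i ∈ I → L i ≤ sum (map L I)
L≤sum {i} i∈I with J , I↭ ← ∈⇒↭∷ i∈I = subst (L i ≤_) (sym (sum-L-↭∷ I↭)) (m≤m+n _ _)

NoConsecutive : List ℕ → Set
NoConsecutive I = ∀ i → i ∈ I → suc i ∉ I

Admissible : List ℕ → Set
Admissible I = Unique I × All (4 ≤_) I × NoConsecutive I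

admissible-[] : Admissible []
admissible-[] = [] , [] , λ _ ()

admissible-∷ : ∀ {n I} → 4 ≤ n → All (λ i → suc i < n) I → Admissible I → Admissible (n ∷ I)
admissible-∷ {n} {I} 4≤n below (unique , ≥4 , noConsecutive) =
  All.map (λ si<n → >⇒≢ (<⇒≤ si<n)) below ∷ unique , 4≤n ∷ ≥4 , noConsecutive′
  where
  noConsecutive′ : NoConsecutive (n ∷ I)
  noConsecutive′ _ (here refl) (here e)     = 1+n≢n e
  noConsecutive′ _ (here refl) (there sn∈I) = <⇒≱ (All.lookup below sn∈I) (m≤n+m n 2)
  noConsecutive′ _ (there i∈I) (here e)     = <-irrefl e (All.lookup below i∈I)
  noConsecutive′ i (there i∈I) (there si∈I) = noConsecutive i i∈I si∈I

admissible-remove : ∀ {n I J} → Admissible I → I ↭ n ∷ J → Admissible J × n ∉ J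
admissible-remove {n} {I} {J} (unique , ≥4 , noConsecutive) I↭
  with n≢J ∷ uniqueJ ← Unique-resp-↭ (setoid ℕ) (↭⇒↭ₛ I↭) unique
  with _ ∷ ≥4J ← All-resp-↭ I↭ ≥4 =
  (uniqueJ , ≥4J , λ i i∈J si∈J → noConsecutive i (J⊆I i∈J) (J⊆I si∈J)) ,
  λ n∈J → All.lookup n≢J n∈J refl
  where
  J⊆I : ∀ {j} → j ∈ J → j ∈ I
  J⊆I = ∈-resp-↭ (↭-sym I↭) ∘ there

-- sums m lists the sums Σ_{i∈I} L_i over admissible I ⊆ {4,…,m+2};
-- sums 0 and sums 1 both list only the empty sum.
sums : ℕ → List ℕ
sums zero          = 0 ∷ []
sums (suc zero)    = 0 ∷ []
sums (suc (suc m)) = sums (suc m) ++ map (L (4 + m) +_) (sums m)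

sums⁺ : ℕ → List ℕ
sums⁺ m = sums m ++ L (3 + m) ∷ []

sums-head : ∀ m → ∃[ r ] sums m ≡ 0 ∷ r
sums-head zero          = _ , refl
sums-head (suc zero)    = _ , refl
sums-head (suc (suc m)) with r , eq ← sums-head (suc m) =
  r ++ map (L (4 + m) +_) (sums m) , cong (_++ map (L (4 + m) +_) (sums m)) eq

sums⁺-suc-suc : ∀ m → sums⁺ (2 + m) ≡ sums (1 + m) ++ map (L (4 + m) +_) (sums⁺ m)
sums⁺-suc-suc m = begin
  (sums (1 + m) ++ map f (sums m)) ++ L (5 + m) ∷ []  ≡⟨ ++-assoc (sums (1 + m)) _ _ ⟩
  sums (1 + m) ++ map f (sums m) ++ map f (L (3 + m) ∷ []) ≡⟨ cong (sums (1 + m) ++_) (map-++ f (sums m) _) ⟨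
  sums (1 + m) ++ map f (sums⁺ m) ∎
  where
  open ≡-Reasoning
  f = L (4 + m) +_

shifted-sums⁺ : ∀ m → ∃[ t ] map (L (4 + m) +_) (sums⁺ m) ≡ L (4 + m) ∷ t
shifted-sums⁺ m with r , eq ← sums-head m =
  map (L (4 + m) +_) (r ++ L (3 + m) ∷ []) ,
  trans (cong (λ xs → map (L (4 + m) +_) (xs ++ L (3 + m) ∷ [])) eq)
        (cong (_∷ map (L (4 + m) +_) (r ++ L (3 + m) ∷ [])) (+-identityʳ (L (4 + m))))

gaps-sums⁺-step : ∀ m → Gaps (sums⁺ (suc m)) (S (2 + m)) → Gaps (sums⁺ m) (S (suc m)) →
  Gaps (sums⁺ (2 + m)) (S (3 + m))
gaps-sums⁺-step m gaps₁ gaps₀ with t , eq ← shifted-sums⁺ m =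
  subst (λ xs → Gaps xs (S (3 + m))) (sym (trans (sums⁺-suc-suc m) (cong (sums (1 + m) ++_) eq)))
    (gaps-++ (sums (1 + m)) gaps₁
      (subst (λ xs → Gaps xs (S (1 + m))) eq (gaps-shift (L (4 + m)) gaps₀)))

gaps-sums⁺ : ∀ m → Gaps (sums⁺ m) (S (suc m))
gaps-sums⁺ zero          = refl ∷ [-]
gaps-sums⁺ (suc zero)    = refl ∷ [-]
gaps-sums⁺ (suc (suc m)) = gaps-sums⁺-step m (gaps-sums⁺ (suc m)) (gaps-sums⁺ m)

AdmissibleSumBelow : ℕ → ℕ → Set
AdmissibleSumBelow b x = ∃[ I ] Admissible I × All (_< b) I × x ≡ sum (map L I)

sums-sound : ∀ m → All (AdmissibleSumBelow (3 + m)) (sums m)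
sums-sound zero          = ([] , admissible-[] , [] , refl) ∷ []
sums-sound (suc zero)    = ([] , admissible-[] , [] , refl) ∷ []
sums-sound (suc (suc m)) =
  All.++⁺ (All.map raise-bound (sums-sound (suc m))) (All.map⁺ (All.map add-top (sums-sound m)))
  where
  raise-bound : ∀ {x} → AdmissibleSumBelow (4 + m) x → AdmissibleSumBelow (5 + m) x
  raise-bound (I , adm , below , eq) = I , adm , All.map m<n⇒m<1+n below , eq

  add-top : ∀ {x} → AdmissibleSumBelow (3 + m) x → AdmissibleSumBelow (5 + m) (L (4 + m) + x)
  add-top (I , adm , below , refl) =
    4 + m ∷ I , admissible-∷ (m≤m+n 4 m) (All.map s≤s below) adm ,
    n<1+n (4 + m) ∷ All.map (m<n⇒m<1+n ∘ m<n⇒m<1+n) below , refl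

SumsComplete : ℕ → Set
SumsComplete m = ∀ {I} → Admissible I → All (_< 3 + m) I → sum (map L I) ∈ sums m

sums-complete-step : ∀ m → SumsComplete (suc m) → SumsComplete m → SumsComplete (2 + m)
sums-complete-step m complete₁ complete₀ {I} adm@(_ , _ , noConsecutive) below with 4 + m ∈? I
... | no n∉I = ∈-++⁺ˡ (complete₁ adm (All.tabulate below′))
  where
  below′ : ∀ {i} → i ∈ I → i < 4 + m
  below′ i∈I = ≤∧≢⇒< (≤-pred (All.lookup below i∈I)) λ { refl → n∉I i∈I }
... | yes n∈I with J , I↭ ← ∈⇒↭∷ n∈I with admJ , n∉J ← admissible-remove adm I↭ =
  subst (_∈ sums (2 + m)) (sym (sum-L-↭∷ I↭))
    (∈-++⁺ʳ (sums (suc m)) (∈-map⁺ (L (4 + m) +_) (complete₀ admJ (All.tabulate belowJ))))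
  where
  -- j ≠ 4 + m by uniqueness, and j ≠ 3 + m as 4 + m ∈ I
  belowJ : ∀ {j} → j ∈ J → j < 3 + m
  belowJ j∈J with j∈I ← ∈-resp-↭ (↭-sym I↭) (there j∈J) =
    ≤∧≢⇒< (≤-pred (≤∧≢⇒< (≤-pred (All.lookup below j∈I)) λ { refl → n∉J j∈J }))
          λ { refl → noConsecutive _ j∈I n∈I }

sums-complete-1 : SumsComplete 1
sums-complete-1 {[]}    _                  _          = here refl
sums-complete-1 {i ∷ _} (_ , 4≤i ∷ _ , _) (i<4 ∷ _) = contradiction i<4 (≤⇒≯ 4≤i)

sums-complete : ∀ m → SumsComplete m
sums-complete zero adm below = sums-complete-1 adm (All.map m<n⇒m<1+n below)
sums-complete (suc zero)    = sums-complete-1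
sums-complete (suc (suc m)) = sums-complete-step m (sums-complete (suc m)) (sums-complete m)

sums-< : ∀ m → All (_< L (3 + m)) (sums m)
sums-< zero          = z<s ∷ []
sums-< (suc zero)    = z<s ∷ []
sums-< (suc (suc m)) =
  All.++⁺ (All.map (λ x< → ≤-trans x< (m≤m+n _ _)) (sums-< (suc m)))
          (All.map⁺ (All.map (+-monoʳ-< (L (4 + m))) (sums-< m)))

sums⁺-≤ : ∀ m {x} → x ∈ sums⁺ m → x ≤ L (3 + m)
sums⁺-≤ m x∈ with ∈-++⁻ (sums m) x∈
... | inj₁ x∈ˡ         = <⇒≤ (All.lookup (sums-< m) x∈ˡ)
... | inj₂ (here refl) = ≤-refl

sums⁺-complete : ∀ m {I} → Admissible I → sum (map L I) ≤ L (3 + m) → sum (map L I) ∈ sums⁺ m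
sums⁺-complete m {I} adm ≤L with m≤n⇒m<n∨m≡n ≤L
... | inj₂ eq = ∈-++⁺ʳ (sums m) (here eq)
... | inj₁ <L = ∈-++⁺ˡ (sums-complete m adm (All.tabulate below))
  where
  below : ∀ {i} → i ∈ I → i < 3 + m
  below i∈I = ≰⇒> λ 3+m≤i → <⇒≱ <L (≤-trans (L-mono-≤ z<s 3+m≤i) (L≤sum i∈I))

admissibleSum-K : ∀ {b x} → AdmissibleSumBelow b x → K (5 + x)
admissibleSum-K (I , (unique , ≥4 , noConsecutive) , _ , eq) =
  I , unique , ≥4 , noConsecutive , cong (5 +_) eq

sums⁺-⊆-K : ∀ m → All K (map (5 +_) (sums⁺ (suc m)))
sums⁺-⊆-K m =
  All.map⁺ (All.++⁺ (All.map admissibleSum-K (sums-sound (suc m))) (admissibleSum-K top ∷ []))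
  where
  top : AdmissibleSumBelow (5 + m) (L (4 + m))
  top = 4 + m ∷ [] , admissible-∷ (m≤m+n 4 m) [] admissible-[] , n<1+n _ ∷ [] , sym (+-identityʳ _)

sums⁺-initialSegment-K : ∀ m → InitialSegment K (map (5 +_) (sums⁺ (suc m)))
sums⁺-initialSegment-K m (I , unique , ≥4 , noConsecutive , refl) z∈ y≤z
  with x , x∈ , refl ← ∈-map⁻ (5 +_) z∈ =
  ∈-map⁺ (5 +_) (sums⁺-complete (suc m) (unique , ≥4 , noConsecutive)
                   (≤-trans (+-cancelˡ-≤ 5 _ _ y≤z) (sums⁺-≤ (suc m) x∈)))

lemma5p1 : (q : ℕ → ℕ) →
    (∀ j → 1 ≤ j → q j < q (suc j)) →
    (∀ j → 1 ≤ j → K (q j)) →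
    (∀ n → K n → Σ ℕ λ j → 1 ≤ j × q j ≡ n) →
    ∀ j k → 1 ≤ j → 2 ≤ k →
      (charAt (S k) j ≡ just A → q (suc j) ≡ q j + L 3) ×
      (charAt (S k) j ≡ just B → q (suc j) ≡ q j + L 4)
lemma5p1 q inc mem surj (suc i) (suc (suc m)) _ (s≤s (s≤s _)) = gap-at A , gap-at B
  where
  window : List ℕ
  window = map (5 +_) (sums⁺ (suc m))

  gaps : Gaps window (S (2 + m))
  gaps = gaps-shift 5 (gaps-sums⁺ (suc m))

  prefix : window IsPrefixOf (q ∘ suc)
  prefix = initialSegment-isPrefix (enumerates-from-1 inc mem surj)
             (Linked⇒AllPairs <-trans (gaps⇒increasing gaps)) (sums⁺-⊆-K m) (sums⁺-initialSegment-K m)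

  gap-at : ∀ c → charAt (S (2 + m)) (suc i) ≡ just c → q (2 + i) ≡ q (1 + i) + gap c
  gap-at c = isPrefix-gap prefix gaps i
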